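{- Let $\alpha=(a,b,A,B)\in\mathcal A_n$ be an arc with $b-a\ge 2$ and let $x\in\,]a,b[$. Then $$\mathrm{SP}(\alpha_x^A)+\mathrm{SP}(\alpha_x^B)=\mathrm{SP}(\alpha_{\bar x})+\mathrm{SP}(\alpha_{\le x})+\mathrm{SP}(\alpha_{\ge x})$$ (Minkowski sums), where $\alpha_x^A=(a,b,A\cup\{x\},B\setminus\{x\})$, $\alpha_x^B=(a,b,A\setminus\{x\},B\cup\{x\})$, $\alpha_{\bar x}=(a,b,A\setminus\{x\},B\setminus\{x\})$ (a pseudoshard), $\alpha_{\le x}=(a,x,A\cap]a,x[,B\cap]a,x[)$ and $\alpha_{\ge x}=(x,b,A\cap]x,b[,B\cap]x,b[)$.
   Context: $]a,b[=\{a+1,\dots,b-1\}$, $(\mathbf e_i)$ the standard basis of $\mathbb R^n$. An arc is a quadruple $(a,b,A,B)$ with $1\le a<b\le n$ and $A\sqcup B=]a,b[$; $\mathcal A_n$ is the set of arcs. More generally a pseudoshard is a quadruple $\alpha=(a,b,A,B)$ with $1\le a<b\le n$ and $A,B$ disjoint subsets of $]a,b[$ (not necessarily covering $]a,b[$). For such $\alpha$, an $\alpha$-alternating matching is a (possibly empty) set $M=\{a_1<b_1<\dots<a_k<b_k\}$ with $a\le a_1$, $b_k\le b$, $a_i\in\{a\}\cup A$, $b_i\in B\cup\{b\}$ (so elements of $]a,b[\setminus(A\cup B)$ are never used); $\chi(M)=\sum_i(\mathbf e_{a_i}-\mathbf e_{b_i})$; and $\mathrm{SP}(\alpha)=\mathrm{conv}\{\chi(M):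 M\ \alpha\text{ -alternating matching}\}$.
   Formalization: The polytopes $\mathrm{SP}(\alpha)$ and their Minkowski sums are taken as sets of points in ℚ^n rather than ℝ^n, with rational convex weights. -}

module Defs where

open import Data.Nat using (ℕ; suc) renaming (_≤_ to _≤ℕ_)
open import Data.Fin using (Fin; toℕ; _<_; _≟_; _<?_)
open import Data.Fin.Subset using (Subset; _∈_; _∩_; _∪_; _-_; ⁅_⁆; Empty)
open import Data.Vec using (tabulate)
open import Data.Bool using (_∧_)
open import Data.List using (List; []; _∷_; map; foldr)
open import Data.Product using (_×_; _,_; Σ; ∃; proj₁; proj₂)
open import Data.Sum using (_⊎_)
open import Data.Unit using (⊤)
open import Relation.Binary.PropositionalEquality using (_≡_)
open import Relation.Nullary.Decidable using (⌊_⌋)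
open import Relation.Nullary using (yes; no)
open import Data.List.Relation.Unary.All using (All)
import Data.Rational as Q
open Q using (ℚ; 0ℚ; 1ℚ)

-- Positions 1..n of the paper are represented by Fin n (0-indexed shift).

⟦_,_⟧ₒ : ∀ {n} → Fin n → Fin n → Subset n
⟦ a , b ⟧ₒ = tabulate (λ i → ⌊ a <? i ⌋ ∧ ⌊ i <? b ⌋)

-- a pseudoshard (a,b,A,B); pseudoshard conditions (a<b, A,B ⊆ ]a,b[, A ∩ B = ∅)
-- are not needed to define SP, they are recorded in IsPseudoshard / IsArc.
record Shard (n : ℕ) : Set where
  constructor shard
  field
    lft rgt : Fin n
    SA SB   : Subset n
open Shard public

IsPseudoshard : ∀ {n} → Shard n → Set
IsPseudoshard (shard a b A B) =
  a < b × (∀ i → i ∈ A → i ∈ ⟦ a , b ⟧ₒ) × (∀ i → i ∈ B → i ∈ ⟦ a , b ⟧ₒ) × Empty (A ∩ B)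

IsArc : ∀ {n} → Shard n → Set
IsArc α = IsPseudoshard α × (∀ i → i ∈ ⟦ lft α , rgt α ⟧ₒ → i ∈ SA α ⊎ i ∈ SB α)

-- A matching {a₁<b₁<…<a_k<b_k} is represented by the list of pairs (aᵢ,bᵢ) in order.
-- AltFrom α s M : M is α-alternating with all elements ≥ s.
AltFrom : ∀ {n} → Shard n → ℕ → List (Fin n × Fin n) → Set
AltFrom α s [] = ⊤
AltFrom α s ((p , q) ∷ M) =
  s ≤ℕ toℕ p × p < q × toℕ q ≤ℕ toℕ (rgt α)
  × (p ≡ lft α ⊎ p ∈ SA α) × (q ∈ SB α ⊎ q ≡ rgt α)
  × AltFrom α (suc (toℕ q)) M

Alternating : ∀ {n} → Shard n → List (Fin n × Fin n) → Set
Alternating α M = AltFrom α (toℕ (lft α)) M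

sumℚ : List ℚ → ℚ
sumℚ = foldr Q._+_ 0ℚ

Pt : ℕ → Set
Pt n = Fin n → ℚ

ind : ∀ {n} → Fin n → Fin n → ℚ
ind i j with i ≟ j
... | yes _ = 1ℚ
... | no  _ = 0ℚ

χ : ∀ {n} → List (Fin n × Fin n) → Pt n
χ M j = sumℚ (map (λ pq → ind (proj₁ pq) j Q.- ind (proj₂ pq) j) M)

-- SP(α) = conv { χ(M) : M α-alternating }, as a predicate on ℚⁿ:
-- y is a convex combination Σ λₖ χ(Mₖ) of finitely many α-alternating matchings.
SP : ∀ {n} → Shard n → Pt n → Set
SP {n} α y = ∃ λ (C : List (ℚ × List (Fin n × Fin n))) →
  All (λ c → 0ℚ Q.≤ proj₁ c × Alternating α (proj₂ c)) C
  × sumℚ (map proj₁ C) ≡ 1ℚ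
  × (∀ j → y j ≡ sumℚ (map (λ c → proj₁ c Q.* χ (proj₂ c) j) C))

_⊕_ : ∀ {n} → (Pt n → Set) → (Pt n → Set) → Pt n → Set
(P ⊕ R) y = ∃ λ p → ∃ λ r → P p × R r × (∀ j → y j ≡ p j Q.+ r j)
infixl 6 _⊕_

αxA αxB αx̄ α≤ α≥ : ∀ {n} → Shard n → Fin n → Shard n
αxA (shard a b A B) x = shard a b (A ∪ ⁅ x ⁆) (B - x)
αxB (shard a b A B) x = shard a b (A - x) (B ∪ ⁅ x ⁆)
αx̄ (shard a b A B) x = shard a b (A - x) (B - x)
α≤ (shard a b A B) x = shard a x (A ∩ ⟦ a , x ⟧ₒ) (B ∩ ⟦ a , x ⟧ₒ)
α≥ (shard a b A B) x = shard x b (A ∩ ⟦ x , b ⟧ₒ) (B ∩ ⟦ x , b ⟧ₒ)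

{-# OPTIONS --safe #-}
module Submission where

-- A Minkowski sum of convex hulls is the hull of the pairwise sums, so both sides are hulls of sums
-- χ(M₁) + χ(M₂), resp. χ(N₀) + χ(N₁) + χ(N₂), and it suffices to turn every pair of α_x^A- and
-- α_x^B-alternating matchings into α_x̄-, α_≤x- and α_≥x-alternating matchings with the same total,
-- and back. In M₁ the point x can only be a left end, in M₂ only a right end. If x is a left end in
-- M₁, the tail of M₁ from x on is the α_≥x matching and the head of M₁ before x the α_≤x one, unless
-- x is also a right end in M₂: then the head of M₂ up to x is the α_≤x matching and the two remaining
-- pieces together form the α_x̄ one. If x is not used in M₁, then M₁ is the α_x̄ matching and M₂ is
-- cut at x, an arc (p, q) across x becoming (p, x) and (x, q) as e_p − e_q = (e_p − e_x) + (e_x − e_q).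
-- Merging reverses these moves.

open import Defs
open import Data.Nat as ℕ using (ℕ; suc; s≤s) renaming (_≤_ to _≤ℕ_)
import Data.Nat.Properties as ℕₚ
open import Data.Fin as Fin using (Fin; toℕ; _<_)
import Data.Fin.Properties as Finₚ
open import Data.Fin.Subset using (Subset; _∈_; _∉_; _─_; _-_; _∪_; _∩_; ⁅_⁆; inside; outside)
open import Data.Fin.Subset.Properties
  using (x∈p∩q⁺; x∈p∩q⁻; x∈p∪q⁺; x∈p∪q⁻; x∈⁅x⁆; x∈⁅y⁆⇒x≡y; p─q⊆p; x∈p∧x≢y⇒x∈p-y)
open import Data.Vec using (_∷_; here; there)
open import Data.Vec.Properties using (lookup∘tabulate; []=⇒lookup; lookup⇒[]=)
open import Data.Bool.Properties using (T-≡; T-∧)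
open import Data.List using (List; []; _∷_; map; _++_)
open import Data.List.Relation.Unary.All as All using (All; []; _∷_)
open import Data.List.Relation.Unary.All.Properties using (++⁺; ++⁻ˡ; ++⁻ʳ; map⁺)
open import Data.Product as Product using (_×_; _,_; ∃; proj₁; proj₂)
open import Data.Product.Function.NonDependent.Propositional using (_×-⇔_)
open import Data.Sum as Sum using (_⊎_; inj₁; inj₂)
open import Data.Sum.Function.Propositional using (_⊎-⇔_)
open import Data.Unit using (⊤; tt)
open import Data.Empty using (⊥-elim)
open import Function using (id; _∘_)
open import Function.Bundles using (_⇔_; mk⇔; module Equivalence)
open import Function.Construct.Composition using (_⇔-∘_)
open import Function.Construct.Identity using (⇔-id)
open import Relation.Nullary using (¬_; yes; no; contradiction)
open import Relation.Nullary.Decidable using (toWitness; fromWitness)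
open import Relation.Unary using (Decidable)
open import Relation.Binary.PropositionalEquality
import Data.Rational as ℚ
open ℚ using (ℚ; 0ℚ; 1ℚ)
import Data.Rational.Properties as ℚₚ
open import Data.Rational.Solver using (module +-*-Solver)

module ConvexHull where

  open import Data.Rational using (_+_; _*_; _≤_; nonNegative)
  open +-*-Solver using (solve; _:=_; _:+_)

  private variable
    n : ℕ
    X Y G H : Set

  ∑ : List X → (X → ℚ) → ℚ
  ∑ C f = sumℚ (map f C)

  ∑-cong : (C : List X) {f g : X → ℚ} → (∀ c → f c ≡ g c) → ∑ C f ≡ ∑ C g
  ∑-cong []      f≡g = refl
  ∑-cong (c ∷ C) f≡g = cong₂ _+_ (f≡g c) (∑-cong C f≡g)

  ∑-+ : (C : List X) (f g : X → ℚ) → ∑ C (λ c → f c + g c) ≡ ∑ C f + ∑ C g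
  ∑-+ []      f g = refl
  ∑-+ (c ∷ C) f g = trans (cong (f c + g c +_) (∑-+ C f g))
    (solve 4 (λ a b s t → (a :+ b) :+ (s :+ t) := (a :+ s) :+ (b :+ t)) refl (f c) (g c) (∑ C f) (∑ C g))

  ∑-*ˡ : (C : List X) (k : ℚ) (f : X → ℚ) → ∑ C (λ c → k * f c) ≡ k * ∑ C f
  ∑-*ˡ []      k f = sym (ℚₚ.*-zeroʳ k)
  ∑-*ˡ (c ∷ C) k f = trans (cong (k * f c +_) (∑-*ˡ C k f)) (sym (ℚₚ.*-distribˡ-+ k (f c) (∑ C f)))

  ∑-++ : (C D : List X) (f : X → ℚ) → ∑ (C ++ D) f ≡ ∑ C f + ∑ D f
  ∑-++ []      D f = sym (ℚₚ.+-identityˡ (∑ D f))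
  ∑-++ (c ∷ C) D f = trans (cong (f c +_) (∑-++ C D f)) (sym (ℚₚ.+-assoc (f c) (∑ C f) (∑ D f)))

  ∑-map : (C : List X) (h : X → Y) (f : Y → ℚ) → ∑ (map h C) f ≡ ∑ C (λ c → f (h c))
  ∑-map []      h f = refl
  ∑-map (c ∷ C) h f = cong (f (h c) +_) (∑-map C h f)

  Weighted : (G → Set) → List (ℚ × G) → Set
  Weighted ok = All (λ c → 0ℚ ≤ proj₁ c × ok (proj₂ c))

  total : List (ℚ × G) → ℚ
  total C = ∑ C proj₁

  barycentre : (G → Pt n) → List (ℚ × G) → Pt n
  barycentre φ C j = ∑ C (λ c → proj₁ c * φ (proj₂ c) j)

  -- SP α unfolds to Hull (Alternating α) χ.
  Hull : (G → Set) → (G → Pt n) → Pt n → Set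
  Hull {G = G} ok φ y =
    ∃ λ (C : List (ℚ × G)) → Weighted ok C × total C ≡ 1ℚ × (∀ j → y j ≡ barycentre φ C j)

  module _ {ok : G → Set} {φ : G → Pt n} where

    Hull-mono : {ok' : H → Set} {φ' : H → Pt n} →
      (∀ {g} → ok g → ∃ λ h → ok' h × (∀ j → φ g j ≡ φ' h j)) →
      ∀ {y} → Hull ok φ y → Hull ok' φ' y
    Hull-mono {ok' = ok'} {φ'} realise (C , w , t , y≡) =
      let D , w' , t' , b = transport C w in D , w' , trans t' t , λ j → trans (y≡ j) (b j)
      where
      transport : (C : List (ℚ × G)) → Weighted ok C → ∃ λ D → Weighted ok' D
        × total D ≡ total C × (∀ j → barycentre φ C j ≡ barycentre φ' D j)
      transport []            []                 = [] , [] , refl , λ _ → refl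
      transport ((l , g) ∷ C) ((l≥0 , okg) ∷ w) =
        let h , okh , φ≡ = realise okg
            D , w' , t , b = transport C w
        in (l , h) ∷ D , (l≥0 , okh) ∷ w' , cong (l +_) t , λ j → cong₂ _+_ (cong (l *_) (φ≡ j)) (b j)

  _⊗_ : List (ℚ × G) → List (ℚ × H) → List (ℚ × (G × H))
  []            ⊗ D = []
  ((l , g) ∷ C) ⊗ D = map (λ d → l * proj₁ d , g , proj₂ d) D ++ C ⊗ D

  _⊠_ : (G → Set) → (H → Set) → G × H → Set
  (ok₁ ⊠ ok₂) gh = ok₁ (proj₁ gh) × ok₂ (proj₂ gh)

  _⊞_ : (G → Pt n) → (H → Pt n) → G × H → Pt n
  (φ₁ ⊞ φ₂) gh j = φ₁ (proj₁ gh) j + φ₂ (proj₂ gh) j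

  Weighted-⊗ : {ok₁ : G → Set} {ok₂ : H → Set} (C : List (ℚ × G)) {D : List (ℚ × H)} →
    Weighted ok₁ C → Weighted ok₂ D → Weighted (ok₁ ⊠ ok₂) (C ⊗ D)
  Weighted-⊗ []            []                  wD = []
  Weighted-⊗ ((l , g) ∷ C) ((l≥0 , okg) ∷ wC) wD =
    ++⁺ (map⁺ (All.map (λ { (m≥0 , okh) → nonNeg-* l≥0 m≥0 , okg , okh }) wD)) (Weighted-⊗ C wC wD)
    where
    nonNeg-* : ∀ {l m} → 0ℚ ≤ l → 0ℚ ≤ m → 0ℚ ≤ l * m
    nonNeg-* {l} {m} l≥0 m≥0 = ℚₚ.nonNegative⁻¹ _
      {{ℚₚ.nonNeg*nonNeg⇒nonNeg l {{nonNegative l≥0}} m {{nonNegative m≥0}}}}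

  ∑-⊗ : (C : List (ℚ × G)) (D : List (ℚ × H)) (F : G × H → ℚ) →
    ∑ (C ⊗ D) (λ c → proj₁ c * F (proj₂ c))
    ≡ ∑ C (λ c → proj₁ c * ∑ D (λ d → proj₁ d * F (proj₂ c , proj₂ d)))
  ∑-⊗ []            D F = refl
  ∑-⊗ ((l , g) ∷ C) D F = begin
    ∑ (map h D ++ C ⊗ D) W                          ≡⟨ ∑-++ (map h D) (C ⊗ D) W ⟩
    ∑ (map h D) W + ∑ (C ⊗ D) W                     ≡⟨ cong₂ _+_ (∑-map D h W) (∑-⊗ C D F) ⟩
    ∑ D (λ d → W (h d)) + _
      ≡⟨ cong (_+ _) (∑-cong D (λ d → ℚₚ.*-assoc l (proj₁ d) _)) ⟩
    ∑ D (λ d → l * (proj₁ d * F (g , proj₂ d))) + _ ≡⟨ cong (_+ _) (∑-*ˡ D l _) ⟩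
    l * ∑ D (λ d → proj₁ d * F (g , proj₂ d)) + _   ∎
    where
    open ≡-Reasoning
    h = λ d → l * proj₁ d , g , proj₂ d
    W = λ c → proj₁ c * F (proj₂ c)

  total≡∑*1 : (C : List (ℚ × G)) → total C ≡ ∑ C (λ c → proj₁ c * 1ℚ)
  total≡∑*1 C = ∑-cong C (λ c → sym (ℚₚ.*-identityʳ (proj₁ c)))

  ∑-affine : (D : List (ℚ × H)) → total D ≡ 1ℚ → (k : ℚ) (f : H → ℚ) →
    ∑ D (λ d → proj₁ d * (k + f (proj₂ d))) ≡ k + ∑ D (λ d → proj₁ d * f (proj₂ d))
  ∑-affine D t k f = begin
    ∑ D (λ d → proj₁ d * (k + f (proj₂ d)))
      ≡⟨ ∑-cong D (λ d → trans (ℚₚ.*-distribˡ-+ (proj₁ d) k _)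
                               (cong (_+ _) (ℚₚ.*-comm (proj₁ d) k))) ⟩
    ∑ D (λ d → k * proj₁ d + proj₁ d * f (proj₂ d))
      ≡⟨ ∑-+ D _ _ ⟩
    ∑ D (λ d → k * proj₁ d) + _
      ≡⟨ cong (_+ _) (trans (∑-*ˡ D k proj₁) (trans (cong (k *_) t) (ℚₚ.*-identityʳ k))) ⟩
    k + ∑ D (λ d → proj₁ d * f (proj₂ d)) ∎
    where open ≡-Reasoning

  module _ {ok₁ : G → Set} {ok₂ : H → Set} {φ₁ : G → Pt n} {φ₂ : H → Pt n} where

    Hull-⊕⇒Hull-⊞ : ∀ {y} →
      (Hull ok₁ φ₁ ⊕ Hull ok₂ φ₂) y → Hull (ok₁ ⊠ ok₂) (φ₁ ⊞ φ₂) y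
    Hull-⊕⇒Hull-⊞ {y} (p , r , (C , wC , tC , p≡) , (D , wD , tD , r≡) , y≡) =
      C ⊗ D , Weighted-⊗ C wC wD , total-⊗ , barycentre-⊗
      where
      open ≡-Reasoning
      total-⊗ : total (C ⊗ D) ≡ 1ℚ
      total-⊗ = begin
        total (C ⊗ D)                                  ≡⟨ total≡∑*1 (C ⊗ D) ⟩
        ∑ (C ⊗ D) (λ c → proj₁ c * 1ℚ)                 ≡⟨ ∑-⊗ C D (λ _ → 1ℚ) ⟩
        ∑ C (λ c → proj₁ c * ∑ D (λ d → proj₁ d * 1ℚ))
          ≡⟨ ∑-cong C (λ c → cong (proj₁ c *_) (trans (sym (total≡∑*1 D)) tD)) ⟩
        ∑ C (λ c → proj₁ c * 1ℚ)                       ≡⟨ trans (sym (total≡∑*1 C)) tC ⟩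
        1ℚ                                             ∎
      barycentre-⊗ : ∀ j → y j ≡ barycentre (φ₁ ⊞ φ₂) (C ⊗ D) j
      barycentre-⊗ j = begin
        y j                                            ≡⟨ trans (y≡ j) (cong₂ _+_ (p≡ j) (r≡ j)) ⟩
        b₁ + b₂                                        ≡⟨ ℚₚ.+-comm b₁ b₂ ⟩
        b₂ + b₁                                        ≡⟨ sym (∑-affine C tC b₂ (λ g → φ₁ g j)) ⟩
        ∑ C (λ c → proj₁ c * (b₂ + φ₁ (proj₂ c) j))    ≡⟨ ∑-cong C (λ c → cong (proj₁ c *_) (inner (proj₂ c))) ⟩
        ∑ C (λ c → proj₁ c * ∑ D (λ d → proj₁ d * (φ₁ ⊞ φ₂) (proj₂ c , proj₂ d) j))
          ≡⟨ sym (∑-⊗ C D (λ gh → (φ₁ ⊞ φ₂) gh j)) ⟩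
        barycentre (φ₁ ⊞ φ₂) (C ⊗ D) j                 ∎
        where
        b₁ b₂ : ℚ
        b₁ = barycentre φ₁ C j
        b₂ = barycentre φ₂ D j
        inner : ∀ g → b₂ + φ₁ g j ≡ ∑ D (λ d → proj₁ d * (φ₁ g j + φ₂ (proj₂ d) j))
        inner g = trans (ℚₚ.+-comm b₂ (φ₁ g j)) (sym (∑-affine D tD (φ₁ g j) (λ h → φ₂ h j)))

    Hull-⊞⇒Hull-⊕ : ∀ {y} →
      Hull (ok₁ ⊠ ok₂) (φ₁ ⊞ φ₂) y → (Hull ok₁ φ₁ ⊕ Hull ok₂ φ₂) y
    Hull-⊞⇒Hull-⊕ (C , w , t , y≡) =
      barycentre φ₁ C₁ , barycentre φ₂ C₂ ,
      (C₁ , map⁺ (All.map (λ (l≥0 , ok , _) → l≥0 , ok) w) , trans (∑-map C h₁ proj₁) t , λ _ → refl) ,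
      (C₂ , map⁺ (All.map (λ (l≥0 , _ , ok) → l≥0 , ok) w) , trans (∑-map C h₂ proj₁) t , λ _ → refl) ,
      λ j → trans (y≡ j) (trans (∑-cong C (λ c → ℚₚ.*-distribˡ-+ (proj₁ c) _ _))
                                (trans (∑-+ C _ _) (sym (cong₂ _+_ (∑-map C h₁ _) (∑-map C h₂ _)))))
      where
      h₁ = λ c → proj₁ c , proj₁ (proj₂ c)
      h₂ = λ c → proj₁ c , proj₂ (proj₂ c)
      C₁ = map h₁ C
      C₂ = map h₂ C

  ⊕-monoˡ : {P P' Q : Pt n → Set} → (∀ {y} → P y → P' y) → ∀ {y} → (P ⊕ Q) y → (P' ⊕ Q) y
  ⊕-monoˡ P⊆P' (p , r , Pp , Qr , y≡) = p , r , P⊆P' Pp , Qr , y≡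

open ConvexHull
open Equivalence using (to; from)
open +-*-Solver using (solve; _:=_; _:+_; _:-_)

open import Data.Nat using (_+_)

Pair : ℕ → Set
Pair n = Fin n × Fin n

private variable
  n s s' e e' m : ℕ
  A : Set
  P Q P' Q' : Fin n → Set
  L M R : List (Pair n)

Within : ℕ → ℕ → Pair n → Set
Within s e (p , q) = s ≤ℕ toℕ p × p < q × toℕ q ℕ.< e

Chain : ℕ → ℕ → List (Pair n) → Set
Chain s e []            = ⊤
Chain s e ((p , q) ∷ M) = Within s e (p , q) × Chain (suc (toℕ q)) e M

Chain-weakenˡ : s' ≤ℕ s → Chain s e M → Chain s' e M
Chain-weakenˡ {M = []}    _    _                   = tt
Chain-weakenˡ {M = _ ∷ _} s'≤s ((s≤p , w) , c) = (ℕₚ.≤-trans s'≤s s≤p , w) , c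

Chain-weakenʳ : e ≤ℕ e' → Chain s e M → Chain s e' M
Chain-weakenʳ {M = []}    _    _                      = tt
Chain-weakenʳ {M = _ ∷ M} e≤e' ((s≤p , p<q , q<e) , c) =
  (s≤p , p<q , ℕₚ.<-≤-trans q<e e≤e') , Chain-weakenʳ {M = M} e≤e' c

Chain-++ : (L : List (Pair n)) → s ≤ℕ m → m ≤ℕ e → Chain s m L → Chain m e R → Chain s e (L ++ R)
Chain-++ []      s≤m m≤e _                      cR = Chain-weakenˡ s≤m cR
Chain-++ (_ ∷ L) s≤m m≤e ((s≤p , p<q , q<m) , cL) cR =
  (s≤p , p<q , ℕₚ.<-≤-trans q<m m≤e) , Chain-++ L q<m m≤e cL cR

Chain-++⁻ : (L : List (Pair n)) {p q : Fin n} → Chain s e (L ++ (p , q) ∷ R) →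
  Chain s (toℕ p) L × Within s e (p , q) × Chain (suc (toℕ q)) e R
Chain-++⁻ []            c = tt , c
Chain-++⁻ ((p' , q') ∷ L) ((s≤p' , p'<q' , _) , c) with Chain-++⁻ L c
... | cL , (q'<p , w) , cR =
  ((s≤p' , p'<q' , q'<p) , cL) ,
  (ℕₚ.≤-trans s≤p' (ℕₚ.≤-trans (ℕₚ.<⇒≤ p'<q') (ℕₚ.<⇒≤ q'<p)) , w) , cR

Chain⇒Within : (M : List (Pair n)) → Chain s e M → All (Within s e) M
Chain⇒Within []            _                      = []
Chain⇒Within ((p , q) ∷ M) ((s≤p , p<q , q<e) , c) =
  (s≤p , p<q , q<e) ∷
  All.map (Product.map₁ (ℕₚ.≤-trans (ℕₚ.≤-trans s≤p (ℕₚ.<⇒≤ p<q)) ∘ ℕₚ.<⇒≤)) (Chain⇒Within M c)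

Chain-empty : (M : List (Pair n)) → e ≤ℕ s → Chain s e M → M ≡ []
Chain-empty []      _   _                      = refl
Chain-empty (_ ∷ _) e≤s ((s≤p , p<q , q<e) , _) =
  ⊥-elim (ℕₚ.<-irrefl refl (ℕₚ.<-≤-trans (ℕₚ.<-trans (ℕₚ.≤-<-trans s≤p p<q) q<e) e≤s))

Chain-lowerʳ : {c : Fin n} (M : List (Pair n)) →
  Chain s (suc (toℕ c)) M → All (λ pq → proj₂ pq ≢ c) M → Chain s (toℕ c) M
Chain-lowerʳ []      _                      _           = tt
Chain-lowerʳ (_ ∷ M) ((s≤p , p<q , q≤c) , c) (q≢c ∷ M≢c) =
  (s≤p , p<q , Finₚ.≤∧≢⇒< (ℕₚ.≤-pred q≤c) q≢c) , Chain-lowerʳ M c M≢c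

data Cut {n : ℕ} (s e c : ℕ) : List (Pair n) → Set where
  clean : ∀ L R → Chain s c L → Chain c e R → Cut s e c (L ++ R)
  span  : ∀ L p q R → Chain s (toℕ p) L → Within s e (p , q) → toℕ p ℕ.< c → c ≤ℕ toℕ q →
          Chain (suc (toℕ q)) e R → Cut s e c (L ++ (p , q) ∷ R)

cut : ∀ c (M : List (Pair n)) → Chain s e M → Cut s e c M
cut c []            _ = clean [] [] tt tt
cut c ((p , q) ∷ M) ((s≤p , p<q , q<e) , cM) with toℕ q ℕ.<? c
... | yes q<c with cut c M cM
...   | clean L R cL cR = clean ((p , q) ∷ L) R ((s≤p , p<q , q<c) , cL) cR
...   | span L p' q' R cL (q<p' , w) p'<c c≤q' cR =
  span ((p , q) ∷ L) p' q' R ((s≤p , p<q , q<p') , cL)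
       (ℕₚ.≤-trans s≤p (ℕₚ.≤-trans (ℕₚ.<⇒≤ p<q) (ℕₚ.<⇒≤ q<p')) , w) p'<c c≤q' cR
cut c ((p , q) ∷ M) ((s≤p , p<q , q<e) , cM) | no q≮c with toℕ p ℕ.<? c
... | yes p<c = span [] p q M tt (s≤p , p<q , q<e) p<c (ℕₚ.≮⇒≥ q≮c) cM
... | no p≮c  = clean [] ((p , q) ∷ M) tt ((ℕₚ.≮⇒≥ p≮c , p<q , q<e) , cM)

data Occurrence (P : A → Set) : List A → Set where
  absent  : ∀ {M} → All (¬_ ∘ P) M → Occurrence P M
  present : ∀ L y R → P y → Occurrence P (L ++ y ∷ R)

occurrence : {P : A → Set} → Decidable P → (M : List A) → Occurrence P M
occurrence P? [] = absent []
occurrence P? (y ∷ M) with P? y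
... | yes Py = present [] y M Py
... | no ¬Py with occurrence P? M
...   | absent ¬PM       = absent (¬Py ∷ ¬PM)
...   | present L y' R Py' = present (y ∷ L) y' R Py'

Labelled : (Fin n → Set) → (Fin n → Set) → Pair n → Set
Labelled P Q (p , q) = P p × Q q

Matching : ℕ → ℕ → (Fin n → Set) → (Fin n → Set) → List (Pair n) → Set
Matching s e P Q M = Chain s e M × All (Labelled P Q) M

Matching-relabel : (∀ {pq} → Within s e pq → Labelled P Q pq → Labelled P' Q' pq) →
  Matching s e P Q M → Matching s e P' Q' M
Matching-relabel {M = M} f (c , l) = c , All.zipWith (λ (w , pq) → f w pq) (Chain⇒Within M c , l)

LeftEnd RightEnd : Shard n → Fin n → Set
LeftEnd  α p = p ≡ lft α ⊎ p ∈ SA α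
RightEnd α q = q ∈ SB α ⊎ q ≡ rgt α

AltFrom⇔Matching : (α : Shard n) (s : ℕ) (M : List (Pair n)) →
  AltFrom α s M ⇔ Matching s (suc (toℕ (rgt α))) (LeftEnd α) (RightEnd α) M
AltFrom⇔Matching α s M = mk⇔ (to′ s M) (from′ s M)
  where
  to′ : ∀ s M → AltFrom α s M → Matching s (suc (toℕ (rgt α))) (LeftEnd α) (RightEnd α) M
  to′ s []            _ = tt , []
  to′ s ((p , q) ∷ M) (s≤p , p<q , q≤b , lp , rq , alt) with to′ (suc (toℕ q)) M alt
  ... | c , l = ((s≤p , p<q , s≤s q≤b) , c) , (lp , rq) ∷ l
  from′ : ∀ s M → Matching s (suc (toℕ (rgt α))) (LeftEnd α) (RightEnd α) M → AltFrom α s M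
  from′ s []            _ = tt
  from′ s ((p , q) ∷ M) (((s≤p , p<q , q<b+1) , c) , (lp , rq) ∷ l) =
    s≤p , p<q , ℕₚ.≤-pred q<b+1 , lp , rq , from′ (suc (toℕ q)) M (c , l)

Matching-⇔ : (∀ {pq} → Within s e pq → Labelled P Q pq ⇔ Labelled P' Q' pq) →
  Matching s e P Q M ⇔ Matching s e P' Q' M
Matching-⇔ f = mk⇔ (Matching-relabel (to ∘ f)) (Matching-relabel (from ∘ f))

Matching-++ : s ≤ℕ m → m ≤ℕ e → Matching s m P Q L → Matching m e P Q R → Matching s e P Q (L ++ R)
Matching-++ {L = L} s≤m m≤e (cL , lL) (cR , lR) = Chain-++ L s≤m m≤e cL cR , ++⁺ lL lR

x∈p─q⇒x∉q : ∀ (p q : Subset n) {i} → i ∈ p ─ q → i ∉ q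
x∈p─q⇒x∉q (inside ∷ p) (outside ∷ q) here       ()
x∈p─q⇒x∉q (_ ∷ p)      (_ ∷ q)       (there i∈) (there i∈q) = x∈p─q⇒x∉q p q i∈ i∈q

x∈p-y⇒x≢y : ∀ {p : Subset n} {i y} → i ∈ p - y → i ≢ y
x∈p-y⇒x≢y {p = p} {y = y} i∈p-y refl = x∈p─q⇒x∉q p ⁅ y ⁆ i∈p-y (x∈⁅x⁆ y)

∈⟦⟧⁻ : ∀ {a b i : Fin n} → i ∈ ⟦ a , b ⟧ₒ → a < i × i < b
∈⟦⟧⁻ {a = a} {b} {i} i∈ with to T-∧ (from T-≡ (trans (sym (lookup∘tabulate _ i)) ([]=⇒lookup i∈)))
... | a<i , i<b = toWitness {a? = a Fin.<? i} a<i , toWitness {a? = i Fin.<? b} i<b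

∈⟦⟧⁺ : ∀ {a b i : Fin n} → a < i → i < b → i ∈ ⟦ a , b ⟧ₒ
∈⟦⟧⁺ {a = a} {b} {i} a<i i<b = lookup⇒[]= i _ (trans (lookup∘tabulate _ i)
  (to T-≡ (from T-∧ (fromWitness {a? = a Fin.<? i} a<i , fromWitness {a? = i Fin.<? b} i<b))))

δ : Fin n → Fin n → Pt n
δ p q j = ind p j ℚ.- ind q j

χ-++ : (L R : List (Pair n)) (j : Fin n) → χ (L ++ R) j ≡ χ L j ℚ.+ χ R j
χ-++ L R j = ∑-++ L R (λ pq → δ (proj₁ pq) (proj₂ pq) j)

χ-∷ʳ : (L : List (Pair n)) (p q j : Fin n) → χ (L ++ (p , q) ∷ []) j ≡ χ L j ℚ.+ δ p q j
χ-∷ʳ L p q j = trans (χ-++ L ((p , q) ∷ []) j) (cong (χ L j ℚ.+_) (ℚₚ.+-identityʳ (δ p q j)))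

δ-split : (p x q j : Fin n) → δ p q j ≡ δ p x j ℚ.+ δ x q j
δ-split p x q j = solve 3 (λ p x q → p :- q := (p :- x) :+ (x :- q)) refl (ind p j) (ind x j) (ind q j)

∈∪⁅x⁆⇔ : ∀ {S : Subset n} {x i} → i ∈ S ∪ ⁅ x ⁆ ⇔ (i ∈ S - x ⊎ i ≡ x)
∈∪⁅x⁆⇔ {S = S} {x} {i} = mk⇔ to′ from′
  where
  to′ : i ∈ S ∪ ⁅ x ⁆ → i ∈ S - x ⊎ i ≡ x
  to′ i∈ with x∈p∪q⁻ S ⁅ x ⁆ i∈ | i Fin.≟ x
  ... | _        | yes i≡x = inj₂ i≡x
  ... | inj₁ i∈S | no i≢x  = inj₁ (x∈p∧x≢y⇒x∈p-y i∈S i≢x)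
  ... | inj₂ i∈x | no i≢x  = contradiction (x∈⁅y⁆⇒x≡y x i∈x) i≢x
  from′ : i ∈ S - x ⊎ i ≡ x → i ∈ S ∪ ⁅ x ⁆
  from′ (inj₁ i∈S-x) = x∈p∪q⁺ (inj₁ (p─q⊆p S ⁅ x ⁆ i∈S-x))
  from′ (inj₂ refl)  = x∈p∪q⁺ (inj₂ (x∈⁅x⁆ x))

module Splitting {n : ℕ} (a b x : Fin n) (A B : Subset n)
  (A⊆ : ∀ i → i ∈ A → i ∈ ⟦ a , b ⟧ₒ) (B⊆ : ∀ i → i ∈ B → i ∈ ⟦ a , b ⟧ₒ)
  (a<x : a < x) (x<b : x < b) where

  α : Shard n
  α = shard a b A B

  left right left⁺ right⁺ : Fin n → Set
  left    = LeftEnd (αx̄ α x)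
  right   = RightEnd (αx̄ α x)
  left⁺ i = left i ⊎ i ≡ x
  right⁺ i = right i ⊎ i ≡ x

  end : ℕ
  end = suc (toℕ b)

  MatchA MatchB Match̄ Match≤ Match≥ : List (Pair n) → Set
  MatchA = Matching (toℕ a) end left⁺ right
  MatchB = Matching (toℕ a) end left right⁺
  Match̄  = Matching (toℕ a) end left right
  Match≤ = Matching (toℕ a) (suc (toℕ x)) left right⁺
  Match≥ = Matching (toℕ x) end left⁺ right

  left⇒≢x : ∀ {i} → left i → i ≢ x
  left⇒≢x (inj₁ refl) = Finₚ.<⇒≢ a<x
  left⇒≢x (inj₂ i∈)   = x∈p-y⇒x≢y i∈

  right⇒≢x : ∀ {i} → right i → i ≢ x
  right⇒≢x (inj₁ i∈)   = x∈p-y⇒x≢y i∈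
  right⇒≢x (inj₂ refl) = Finₚ.<⇒≢ x<b ∘ sym

  drop-x : ∀ {P : Fin n → Set} {i} → P i ⊎ i ≡ x → i ≢ x → P i
  drop-x (inj₁ Pi)  _   = Pi
  drop-x (inj₂ i≡x) i≢x = contradiction i≡x i≢x

  below-x : ∀ {S : Subset n} {i} → (∀ j → j ∈ S → j ∈ ⟦ a , b ⟧ₒ) →
    i < x → i ∈ S ∩ ⟦ a , x ⟧ₒ ⇔ i ∈ S - x
  below-x {S} S⊆ i<x = mk⇔
    (λ i∈ → x∈p∧x≢y⇒x∈p-y (proj₁ (x∈p∩q⁻ S _ i∈)) (Finₚ.<⇒≢ i<x))
    (λ i∈ → let i∈S = p─q⊆p S ⁅ x ⁆ i∈
            in x∈p∩q⁺ (i∈S , ∈⟦⟧⁺ (proj₁ (∈⟦⟧⁻ (S⊆ _ i∈S))) i<x))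

  above-x : ∀ {S : Subset n} {i} → (∀ j → j ∈ S → j ∈ ⟦ a , b ⟧ₒ) →
    x < i → i ∈ S ∩ ⟦ x , b ⟧ₒ ⇔ i ∈ S - x
  above-x {S} S⊆ x<i = mk⇔
    (λ i∈ → x∈p∧x≢y⇒x∈p-y (proj₁ (x∈p∩q⁻ S _ i∈)) (Finₚ.<⇒≢ x<i ∘ sym))
    (λ i∈ → let i∈S = p─q⊆p S ⁅ x ⁆ i∈
            in x∈p∩q⁺ (i∈S , ∈⟦⟧⁺ x<i (proj₂ (∈⟦⟧⁻ (S⊆ _ i∈S)))))

  LeftEnd-αxA : ∀ {i} → LeftEnd (αxA α x) i ⇔ left⁺ i
  LeftEnd-αxA = mk⇔ to′ from′
    where
    to′ : ∀ {i} → LeftEnd (αxA α x) i → left⁺ i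
    to′ (inj₁ i≡a) = inj₁ (inj₁ i≡a)
    to′ (inj₂ i∈)  = Sum.map₁ inj₂ (to ∈∪⁅x⁆⇔ i∈)
    from′ : ∀ {i} → left⁺ i → LeftEnd (αxA α x) i
    from′ (inj₁ (inj₁ i≡a)) = inj₁ i≡a
    from′ (inj₁ (inj₂ i∈))  = inj₂ (from ∈∪⁅x⁆⇔ (inj₁ i∈))
    from′ (inj₂ i≡x)        = inj₂ (from ∈∪⁅x⁆⇔ (inj₂ i≡x))

  RightEnd-αxB : ∀ {i} → RightEnd (αxB α x) i ⇔ right⁺ i
  RightEnd-αxB = mk⇔ to′ from′
    where
    to′ : ∀ {i} → RightEnd (αxB α x) i → right⁺ i
    to′ (inj₁ i∈)  = Sum.map₁ inj₁ (to ∈∪⁅x⁆⇔ i∈)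
    to′ (inj₂ i≡b) = inj₁ (inj₂ i≡b)
    from′ : ∀ {i} → right⁺ i → RightEnd (αxB α x) i
    from′ (inj₁ (inj₁ i∈))  = inj₁ (from ∈∪⁅x⁆⇔ (inj₁ i∈))
    from′ (inj₁ (inj₂ i≡b)) = inj₂ i≡b
    from′ (inj₂ i≡x)        = inj₁ (from ∈∪⁅x⁆⇔ (inj₂ i≡x))

  LeftEnd-α≤ : ∀ {i} → i < x → LeftEnd (α≤ α x) i ⇔ left i
  LeftEnd-α≤ i<x = ⇔-id _ ⊎-⇔ below-x A⊆ i<x

  RightEnd-α≤ : ∀ {i} → i Fin.≤ x → RightEnd (α≤ α x) i ⇔ right⁺ i
  RightEnd-α≤ {i} i≤x = mk⇔ to′ from′
    where
    to′ : RightEnd (α≤ α x) i → right⁺ i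
    to′ (inj₁ i∈)  = inj₁ (inj₁ (to (below-x B⊆ i<x) i∈))
      where i<x = proj₂ (∈⟦⟧⁻ (proj₂ (x∈p∩q⁻ B _ i∈)))
    to′ (inj₂ i≡x) = inj₂ i≡x
    from′ : right⁺ i → RightEnd (α≤ α x) i
    from′ (inj₁ (inj₁ i∈))   = inj₁ (from (below-x B⊆ (Finₚ.≤∧≢⇒< i≤x (x∈p-y⇒x≢y i∈))) i∈)
    from′ (inj₁ (inj₂ refl)) = contradiction (ℕₚ.<-≤-trans x<b i≤x) (ℕₚ.<-irrefl refl)
    from′ (inj₂ i≡x)         = inj₂ i≡x

  LeftEnd-α≥ : ∀ {i} → x Fin.≤ i → LeftEnd (α≥ α x) i ⇔ left⁺ i
  LeftEnd-α≥ {i} x≤i = mk⇔ to′ from′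
    where
    to′ : LeftEnd (α≥ α x) i → left⁺ i
    to′ (inj₁ i≡x) = inj₂ i≡x
    to′ (inj₂ i∈)  = inj₁ (inj₂ (to (above-x A⊆ x<i) i∈))
      where x<i = proj₁ (∈⟦⟧⁻ (proj₂ (x∈p∩q⁻ A _ i∈)))
    from′ : left⁺ i → LeftEnd (α≥ α x) i
    from′ (inj₁ (inj₁ refl)) = contradiction (ℕₚ.<-≤-trans a<x x≤i) (ℕₚ.<-irrefl refl)
    from′ (inj₁ (inj₂ i∈))   =
      inj₂ (from (above-x A⊆ (Finₚ.≤∧≢⇒< x≤i (x∈p-y⇒x≢y i∈ ∘ sym))) i∈)
    from′ (inj₂ i≡x)         = inj₁ i≡x

  RightEnd-α≥ : ∀ {i} → x < i → RightEnd (α≥ α x) i ⇔ right i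
  RightEnd-α≥ x<i = above-x B⊆ x<i ⊎-⇔ ⇔-id _

  αxA-matching : ∀ M → Alternating (αxA α x) M ⇔ MatchA M
  αxA-matching M = Matching-⇔ (λ _ → LeftEnd-αxA ×-⇔ ⇔-id _) ⇔-∘ AltFrom⇔Matching (αxA α x) (toℕ a) M

  αxB-matching : ∀ M → Alternating (αxB α x) M ⇔ MatchB M
  αxB-matching M = Matching-⇔ (λ _ → ⇔-id _ ×-⇔ RightEnd-αxB) ⇔-∘ AltFrom⇔Matching (αxB α x) (toℕ a) M

  αx̄-matching : ∀ M → Alternating (αx̄ α x) M ⇔ Match̄ M
  αx̄-matching = AltFrom⇔Matching (αx̄ α x) (toℕ a)

  α≤-matching : ∀ M → Alternating (α≤ α x) M ⇔ Match≤ M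
  α≤-matching M = Matching-⇔ bounds ⇔-∘ AltFrom⇔Matching (α≤ α x) (toℕ a) M
    where
    bounds : ∀ {pq} → Within (toℕ a) (suc (toℕ x)) pq →
      Labelled (LeftEnd (α≤ α x)) (RightEnd (α≤ α x)) pq ⇔ Labelled left right⁺ pq
    bounds (_ , p<q , q<x+1) = LeftEnd-α≤ (ℕₚ.<-≤-trans p<q q≤x) ×-⇔ RightEnd-α≤ q≤x
      where q≤x = ℕₚ.≤-pred q<x+1

  α≥-matching : ∀ M → Alternating (α≥ α x) M ⇔ Match≥ M
  α≥-matching M = Matching-⇔ bounds ⇔-∘ AltFrom⇔Matching (α≥ α x) (toℕ x) M
    where
    bounds : ∀ {pq} → Within (toℕ x) end pq →
      Labelled (LeftEnd (α≥ α x)) (RightEnd (α≥ α x)) pq ⇔ Labelled left⁺ right pq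
    bounds (x≤p , p<q , _) = LeftEnd-α≥ x≤p ×-⇔ RightEnd-α≥ (ℕₚ.≤-<-trans x≤p p<q)

  Avoids-x : Pair n → Set
  Avoids-x pq = proj₁ pq ≢ x × proj₂ pq ≢ x

  above-x-avoids : ∀ {s e pq} → toℕ x ℕ.< s → Within s e pq → Avoids-x pq
  above-x-avoids x<s (s≤p , p<q , _) =
    Finₚ.<⇒≢ x<p ∘ sym , Finₚ.<⇒≢ (ℕₚ.<-trans x<p p<q) ∘ sym
    where x<p = ℕₚ.<-≤-trans x<s s≤p

  below-x-avoids : ∀ {s pq} → Within s (toℕ x) pq → Avoids-x pq
  below-x-avoids (_ , p<q , q<x) = Finₚ.<⇒≢ (ℕₚ.<-trans p<q q<x) , Finₚ.<⇒≢ q<x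

  -- Away from x, the endpoint conditions of all five shards agree.
  relabel-avoiding : ∀ {s e M} {P Q P' Q' : Fin n → Set} → (∀ {pq} → Within s e pq → Avoids-x pq) →
    (∀ {i} → P i → left⁺ i) → (∀ {i} → Q i → right⁺ i) →
    (∀ {i} → left i → P' i) → (∀ {i} → right i → Q' i) →
    Matching s e P Q M → Matching s e P' Q' M
  relabel-avoiding avoids P⊆ Q⊆ ⊆P' ⊆Q' = Matching-relabel λ w (Pp , Qq) →
    ⊆P' (drop-x {P = left} (P⊆ Pp) (proj₁ (avoids w))) , ⊆Q' (drop-x {P = right} (Q⊆ Qq) (proj₂ (avoids w)))

  Decomposition : List (Pair n) × List (Pair n) → Set
  Decomposition M =
    ∃ λ N → ((Match̄ ⊠ Match≤) ⊠ Match≥) N × (∀ j → (χ ⊞ χ) M j ≡ ((χ ⊞ χ) ⊞ χ) N j)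

  split-x∉ : ∀ {M₁ M₂} → Match̄ M₁ → MatchB M₂ → Decomposition (M₁ , M₂)
  split-x∉ {M₁} {M₂} m₁ (c₂ , l₂) with cut (suc (toℕ x)) M₂ c₂
  ... | clean L R cL cR =
    ((M₁ , L) , R) , ((m₁ , (cL , ++⁻ˡ L l₂)) , m≥) , λ j → begin
      χ M₁ j ℚ.+ χ (L ++ R) j        ≡⟨ cong (χ M₁ j ℚ.+_) (χ-++ L R j) ⟩
      χ M₁ j ℚ.+ (χ L j ℚ.+ χ R j)   ≡⟨ sym (ℚₚ.+-assoc (χ M₁ j) _ _) ⟩
      (χ M₁ j ℚ.+ χ L j) ℚ.+ χ R j   ∎
    where
    open ≡-Reasoning
    m≥ : Match≥ R
    m≥ = Product.map₁ (Chain-weakenˡ (ℕₚ.n≤1+n _))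
           (relabel-avoiding (above-x-avoids ℕₚ.≤-refl) inj₁ id inj₁ id (cR , ++⁻ʳ L l₂))
  ... | span L p q R cL (a≤p , _ , q<end) p<x+1 x<q cR with ++⁻ʳ L l₂
  ...   | (lp , rq) ∷ lR =
    ((M₁ , L ++ (p , x) ∷ []) , (x , q) ∷ R) , ((m₁ , m≤) , m≥) , λ j → begin
      χ M₁ j ℚ.+ χ (L ++ (p , q) ∷ R) j
        ≡⟨ cong (χ M₁ j ℚ.+_) (χ-++ L ((p , q) ∷ R) j) ⟩
      χ M₁ j ℚ.+ (χ L j ℚ.+ (δ p q j ℚ.+ χ R j))
        ≡⟨ cong (λ d → χ M₁ j ℚ.+ (χ L j ℚ.+ (d ℚ.+ χ R j))) (δ-split p x q j) ⟩
      χ M₁ j ℚ.+ (χ L j ℚ.+ ((δ p x j ℚ.+ δ x q j) ℚ.+ χ R j))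
        ≡⟨ solve 5 (λ m l d d' r → m :+ (l :+ ((d :+ d') :+ r)) := (m :+ (l :+ d)) :+ (d' :+ r))
                 refl (χ M₁ j) (χ L j) (δ p x j) (δ x q j) (χ R j) ⟩
      (χ M₁ j ℚ.+ (χ L j ℚ.+ δ p x j)) ℚ.+ χ ((x , q) ∷ R) j
        ≡⟨ cong (λ t → (χ M₁ j ℚ.+ t) ℚ.+ χ ((x , q) ∷ R) j) (sym (χ-∷ʳ L p x j)) ⟩
      (χ M₁ j ℚ.+ χ (L ++ (p , x) ∷ []) j) ℚ.+ χ ((x , q) ∷ R) j ∎
    where
    open ≡-Reasoning
    p<x : p < x
    p<x = Finₚ.≤∧≢⇒< (ℕₚ.≤-pred p<x+1) (left⇒≢x lp)
    m≤ : Match≤ (L ++ (p , x) ∷ [])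
    m≤ = Matching-++ a≤p (ℕₚ.<⇒≤ p<x+1) (cL , ++⁻ˡ L l₂)
           (((ℕₚ.≤-refl , p<x , ℕₚ.≤-refl) , tt) , (lp , inj₂ refl) ∷ [])
    m≥ : Match≥ ((x , q) ∷ R)
    m≥ = ((ℕₚ.≤-refl , x<q , q<end) , proj₁ tail) ,
         (inj₂ refl , drop-x {P = right} rq (Finₚ.<⇒≢ x<q ∘ sym)) ∷ proj₂ tail
      where tail = relabel-avoiding (above-x-avoids (ℕₚ.<-trans x<q ℕₚ.≤-refl)) inj₁ id inj₁ id (cR , lR)

  split-x∈ : ∀ L₁ q₁ R₁ {M₂} → MatchA (L₁ ++ (x , q₁) ∷ R₁) → MatchB M₂ →
    Decomposition (L₁ ++ (x , q₁) ∷ R₁ , M₂)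
  split-x∈ L₁ q₁ R₁ {M₂} (c₁ , l₁) (c₂ , l₂)
    with Chain-++⁻ L₁ c₁ | occurrence (λ pq → proj₂ pq Fin.≟ x) M₂
  ... | cL₁ , (_ , x<q₁ , q₁<end) , cR₁ | absent x∉M₂ =
    ((M₂ , L₁) , X) , ((m̄ , m≤) , m≥) , λ j → begin
      χ (L₁ ++ X) j ℚ.+ χ M₂ j               ≡⟨ cong (ℚ._+ χ M₂ j) (χ-++ L₁ X j) ⟩
      (χ L₁ j ℚ.+ χ X j) ℚ.+ χ M₂ j
        ≡⟨ solve 3 (λ l y m → (l :+ y) :+ m := (m :+ l) :+ y) refl (χ L₁ j) (χ X j) (χ M₂ j) ⟩
      (χ M₂ j ℚ.+ χ L₁ j) ℚ.+ χ X j          ∎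
    where
    open ≡-Reasoning
    X = (x , q₁) ∷ R₁
    m̄ : Match̄ M₂
    m̄ = c₂ , All.zipWith (λ (q≢x , lp , rq) → lp , drop-x {P = right} rq q≢x) (x∉M₂ , l₂)
    m≤ : Match≤ L₁
    m≤ = Product.map₁ (Chain-weakenʳ (ℕₚ.n≤1+n _))
           (relabel-avoiding below-x-avoids id inj₁ id inj₁ (cL₁ , ++⁻ˡ L₁ l₁))
    m≥ : Match≥ X
    m≥ = ((ℕₚ.≤-refl , x<q₁ , q₁<end) , cR₁) , ++⁻ʳ L₁ l₁
  ... | cL₁ , (_ , x<q₁ , q₁<end) , cR₁ | present L₂ (p₂ , q₂) R₂ refl
    with Chain-++⁻ L₂ c₂ | ++⁻ʳ L₂ l₂
  ...   | cL₂ , (a≤p₂ , p₂<x , _) , cR₂ | l-p₂x ∷ lR₂ =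
    ((L₁ ++ R₂ , L₂ ++ (p₂ , x) ∷ []) , X) , ((m̄ , m≤) , m≥) , λ j → begin
      χ (L₁ ++ X) j ℚ.+ χ (L₂ ++ (p₂ , x) ∷ R₂) j
        ≡⟨ cong₂ ℚ._+_ (χ-++ L₁ X j) (χ-++ L₂ ((p₂ , x) ∷ R₂) j) ⟩
      (χ L₁ j ℚ.+ χ X j) ℚ.+ (χ L₂ j ℚ.+ (δ p₂ x j ℚ.+ χ R₂ j))
        ≡⟨ solve 5 (λ l₁ y l₂ d r₂ → (l₁ :+ y) :+ (l₂ :+ (d :+ r₂)) := ((l₁ :+ r₂) :+ (l₂ :+ d)) :+ y)
                 refl (χ L₁ j) (χ X j) (χ L₂ j) (δ p₂ x j) (χ R₂ j) ⟩
      ((χ L₁ j ℚ.+ χ R₂ j) ℚ.+ (χ L₂ j ℚ.+ δ p₂ x j)) ℚ.+ χ X j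
        ≡⟨ cong₂ (λ s t → (s ℚ.+ t) ℚ.+ χ X j) (sym (χ-++ L₁ R₂ j)) (sym (χ-∷ʳ L₂ p₂ x j)) ⟩
      (χ (L₁ ++ R₂) j ℚ.+ χ (L₂ ++ (p₂ , x) ∷ []) j) ℚ.+ χ X j ∎
    where
    open ≡-Reasoning
    X = (x , q₁) ∷ R₁
    x≤end : suc (toℕ x) ≤ℕ end
    x≤end = s≤s (ℕₚ.<⇒≤ x<b)
    m̄ : Match̄ (L₁ ++ R₂)
    m̄ = Matching-++ (ℕₚ.≤-trans (ℕₚ.<⇒≤ a<x) (ℕₚ.n≤1+n _)) x≤end
          (Product.map₁ (Chain-weakenʳ (ℕₚ.n≤1+n _))
            (relabel-avoiding below-x-avoids id inj₁ id id (cL₁ , ++⁻ˡ L₁ l₁)))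
          (relabel-avoiding (above-x-avoids ℕₚ.≤-refl) inj₁ id id id (cR₂ , lR₂))
    m≤ : Match≤ (L₂ ++ (p₂ , x) ∷ [])
    m≤ = Matching-++ a≤p₂ (ℕₚ.≤-trans (ℕₚ.<⇒≤ p₂<x) (ℕₚ.n≤1+n _)) (cL₂ , ++⁻ˡ L₂ l₂)
          (((ℕₚ.≤-refl , p₂<x , ℕₚ.≤-refl) , tt) , l-p₂x ∷ [])
    m≥ : Match≥ X
    m≥ = ((ℕₚ.≤-refl , x<q₁ , q₁<end) , cR₁) , ++⁻ʳ L₁ l₁

  split : ∀ {M₁ M₂} → MatchA M₁ → MatchB M₂ → Decomposition (M₁ , M₂)
  split {M₁} (c₁ , l₁) m₂ with occurrence (λ pq → proj₁ pq Fin.≟ x) M₁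
  ... | absent x∉M₁                 =
    split-x∉ (c₁ , All.zipWith (λ (p≢x , lp , rq) → drop-x {P = left} lp p≢x , rq) (x∉M₁ , l₁)) m₂
  ... | present L₁ (p , q₁) R₁ refl = split-x∈ L₁ q₁ R₁ (c₁ , l₁) m₂

  Recomposition : (List (Pair n) × List (Pair n)) × List (Pair n) → Set
  Recomposition N =
    ∃ λ M → (MatchA ⊠ MatchB) M × (∀ j → ((χ ⊞ χ) ⊞ χ) N j ≡ (χ ⊞ χ) M j)

  Match̄⇒MatchA : ∀ {M} → Match̄ M → MatchA M
  Match̄⇒MatchA = Matching-relabel (λ _ → Product.map₁ inj₁)

  Match̄⇒MatchB : ∀ {M} → Match̄ M → MatchB M
  Match̄⇒MatchB = Matching-relabel (λ _ → Product.map₂ inj₁)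

  merge-x∉ : ∀ {N₀ N₁ N₂} → Match̄ N₀ → Match≤ N₁ → Matching (suc (toℕ x)) end left⁺ right N₂ →
    Recomposition ((N₀ , N₁) , N₂)
  merge-x∉ {N₀} {N₁} {N₂} m₀ m₁ m₂ =
    (N₀ , N₁ ++ N₂) ,
    (Match̄⇒MatchA m₀ ,
     Matching-++ (ℕₚ.≤-trans (ℕₚ.<⇒≤ a<x) (ℕₚ.n≤1+n _)) (s≤s (ℕₚ.<⇒≤ x<b)) m₁
       (relabel-avoiding (above-x-avoids ℕₚ.≤-refl) id inj₁ id inj₁ m₂)) ,
    λ j → trans (ℚₚ.+-assoc (χ N₀ j) (χ N₁ j) (χ N₂ j)) (cong (χ N₀ j ℚ.+_) (sym (χ-++ N₁ N₂ j)))

  merge-x∈ : ∀ {N₀ N₁} q R → Match̄ N₀ → Match≤ N₁ → Match≥ ((x , q) ∷ R) →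
    Recomposition ((N₀ , N₁) , (x , q) ∷ R)
  merge-x∈ {N₀} {N₁} q R m₀ (c₁ , l₁) m₂@(((_ , x<q , q<end) , cR) , (_ , rq) ∷ lR)
    with occurrence (λ pq → proj₂ pq Fin.≟ x) N₁
  ... | absent x∉N₁ =
    (N₁ ++ X , N₀) ,
    (Matching-++ (ℕₚ.<⇒≤ a<x) (ℕₚ.≤-trans (ℕₚ.<⇒≤ x<b) (ℕₚ.n≤1+n _)) m₁ m₂ , Match̄⇒MatchB m₀) ,
    λ j → begin
      (χ N₀ j ℚ.+ χ N₁ j) ℚ.+ χ X j
        ≡⟨ solve 3 (λ m l y → (m :+ l) :+ y := (l :+ y) :+ m) refl (χ N₀ j) (χ N₁ j) (χ X j) ⟩
      (χ N₁ j ℚ.+ χ X j) ℚ.+ χ N₀ j ≡⟨ cong (ℚ._+ χ N₀ j) (sym (χ-++ N₁ X j)) ⟩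
      χ (N₁ ++ X) j ℚ.+ χ N₀ j      ∎
    where
    open ≡-Reasoning
    X = (x , q) ∷ R
    m₁ : Matching (toℕ a) (toℕ x) left⁺ right N₁
    m₁ = relabel-avoiding below-x-avoids inj₁ id inj₁ id (Chain-lowerʳ N₁ c₁ x∉N₁ , l₁)
  ... | present L (p₁ , q₁) R' refl with Chain-++⁻ L c₁ | ++⁻ʳ L l₁
  ...   | cL , (a≤p₁ , p₁<x , _) , cR' | (lp₁ , _) ∷ _ with Chain-empty R' ℕₚ.≤-refl cR'
  ...     | refl =
    (N₀ , L ++ (p₁ , q) ∷ R) ,
    (Match̄⇒MatchA m₀ , Matching-++ a≤p₁ (ℕₚ.<⇒≤ (ℕₚ.<-trans p₁<q q<end)) (cL , ++⁻ˡ L l₁) m-p₁q) ,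
    λ j → begin
      (χ N₀ j ℚ.+ χ (L ++ (p₁ , x) ∷ []) j) ℚ.+ χ ((x , q) ∷ R) j
        ≡⟨ cong (λ t → (χ N₀ j ℚ.+ t) ℚ.+ χ ((x , q) ∷ R) j) (χ-∷ʳ L p₁ x j) ⟩
      (χ N₀ j ℚ.+ (χ L j ℚ.+ δ p₁ x j)) ℚ.+ (δ x q j ℚ.+ χ R j)
        ≡⟨ solve 5 (λ m l d d' r → (m :+ (l :+ d)) :+ (d' :+ r) := m :+ (l :+ ((d :+ d') :+ r)))
                 refl (χ N₀ j) (χ L j) (δ p₁ x j) (δ x q j) (χ R j) ⟩
      χ N₀ j ℚ.+ (χ L j ℚ.+ ((δ p₁ x j ℚ.+ δ x q j) ℚ.+ χ R j))
        ≡⟨ cong (λ d → χ N₀ j ℚ.+ (χ L j ℚ.+ (d ℚ.+ χ R j))) (sym (δ-split p₁ x q j)) ⟩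
      χ N₀ j ℚ.+ (χ L j ℚ.+ χ ((p₁ , q) ∷ R) j)
        ≡⟨ cong (χ N₀ j ℚ.+_) (sym (χ-++ L ((p₁ , q) ∷ R) j)) ⟩
      χ N₀ j ℚ.+ χ (L ++ (p₁ , q) ∷ R) j ∎
    where
    open ≡-Reasoning
    p₁<q : p₁ < q
    p₁<q = ℕₚ.<-trans p₁<x x<q
    m-p₁q : Matching (toℕ p₁) end left right⁺ ((p₁ , q) ∷ R)
    m-p₁q = ((ℕₚ.≤-refl , p₁<q , q<end) , proj₁ mR) , (lp₁ , inj₁ rq) ∷ proj₂ mR
      where mR = relabel-avoiding (above-x-avoids (ℕₚ.<-trans x<q ℕₚ.≤-refl)) id inj₁ id inj₁ (cR , lR)

  merge : ∀ {N₀ N₁ N₂} → Match̄ N₀ → Match≤ N₁ → Match≥ N₂ → Recomposition ((N₀ , N₁) , N₂)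
  merge {N₂ = []} m₀ m₁ m₂ = merge-x∉ m₀ m₁ m₂
  merge {N₂ = (p , q) ∷ R} m₀ m₁ m₂ with p Fin.≟ x
  merge {N₂ = (p , q) ∷ R} m₀ m₁ m₂                                | yes refl = merge-x∈ q R m₀ m₁ m₂
  merge {N₂ = (p , q) ∷ R} m₀ m₁ (((x≤p , p<q , q<end) , cR) , lN₂) | no p≢x   =
    merge-x∉ m₀ m₁ (((Finₚ.≤∧≢⇒< x≤p (p≢x ∘ sym) , p<q , q<end) , cR) , lN₂)

  split-alternating : ∀ {M} → (Alternating (αxA α x) ⊠ Alternating (αxB α x)) M →
    ∃ λ N → ((Alternating (αx̄ α x) ⊠ Alternating (α≤ α x)) ⊠ Alternating (α≥ α x)) N
          × (∀ j → (χ ⊞ χ) M j ≡ ((χ ⊞ χ) ⊞ χ) N j)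
  split-alternating {M₁ , M₂} (alt₁ , alt₂)
    with split (to (αxA-matching M₁) alt₁) (to (αxB-matching M₂) alt₂)
  ... | ((N₀ , N₁) , N₂) , ((m₀ , m₁) , m₂) , eq =
    ((N₀ , N₁) , N₂) ,
    ((from (αx̄-matching N₀) m₀ , from (α≤-matching N₁) m₁) , from (α≥-matching N₂) m₂) , eq

  merge-alternating : ∀ {N} → ((Alternating (αx̄ α x) ⊠ Alternating (α≤ α x)) ⊠ Alternating (α≥ α x)) N →
    ∃ λ M → (Alternating (αxA α x) ⊠ Alternating (αxB α x)) M × (∀ j → ((χ ⊞ χ) ⊞ χ) N j ≡ (χ ⊞ χ) M j)
  merge-alternating {(N₀ , N₁) , N₂} ((alt₀ , alt₁) , alt₂)
    with merge (to (αx̄-matching N₀) alt₀) (to (α≤-matching N₁) alt₁) (to (α≥-matching N₂) alt₂)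
  ... | (M₁ , M₂) , (m₁ , m₂) , eq =
    (M₁ , M₂) , (from (αxA-matching M₁) m₁ , from (αxB-matching M₂) m₂) , eq

theorem57 : (n : ℕ) (α : Shard n) → IsArc α → toℕ (lft α) + 2 ≤ℕ toℕ (rgt α)
    → (x : Fin n) → lft α < x → x < rgt α
    → (y : Pt n) → (SP (αxA α x) ⊕ SP (αxB α x)) y ⇔ (SP (αx̄ α x) ⊕ SP (α≤ α x) ⊕ SP (α≥ α x)) y
theorem57 n (shard a b A B) ((_ , A⊆ , B⊆ , _) , _) _ x a<x x<b y = mk⇔
  (λ s → ⊕-monoˡ Hull-⊞⇒Hull-⊕ (Hull-⊞⇒Hull-⊕ (Hull-mono split-alternating (Hull-⊕⇒Hull-⊞ s))))
  (λ s → Hull-⊞⇒Hull-⊕ (Hull-mono merge-alternating (Hull-⊕⇒Hull-⊞ (⊕-monoˡ Hull-⊕⇒Hull-⊞ s))))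
  where open Splitting a b x A B A⊆ B⊆ a<x x<b
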